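{- Let $\Delta$ be the polar geometry of the real projective quadric $Q(X_0,\dots,X_6)=X_0^2+X_1^2+X_2^2-X_3^2-X_4^2-X_5^2-X_6^2=0$, and let $H$ be the group of left isoclinic rotations acting on the coordinates $(X_3,X_4,X_5,X_6)$ (and trivially on $X_0,X_1,X_2$). Then no non-identity element of $H$ maps a point $p$ of $\Delta$ to a point collinear with (or equal to) $p$; that is, for every singular point $p$ and every $h\in H\setminus\{1\}$, $B(p,h(p))\neq0$, where $B(x,y)=\tfrac12(Q(x+y)-Q(x)-Q(y))$.
   Context: Points of $\Delta$ are the $1$-dimensional subspaces of $\mathbb{R}^7$ on which $Q$ vanishes; two points $p,q$ are collinear (or equal) iff $B(p,q)=0$. Identify $\mathbb{R}^4$ (coordinates $X_3,\dots,X_6$) with the quaternions $\mathbb{H}$; the left isoclinic rotations are the maps $v\mapsto qv$ for unit quaternions $q$, forming a group isomorphic to $\mathsf{SU}(2)$ that acts sharply transitively on the unit sphere $\mathbb{S}^3\subset\mathbb{R}^4$. $H$ acts on $\mathbb{R}^7$ by such a rotation on the last four coordinates and the identity on the first three, hence on $\Delta$. -}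

module Defs where

open import Level using (0ℓ)
open import Data.Fin using (Fin; zero; suc)
open import Data.Product using (Σ; ∃; _×_; _,_)
open import Data.Sum using (_⊎_)
open import Relation.Binary.PropositionalEquality using (_≡_)
open import Relation.Nullary using (¬_)
open import Algebra.Structures using (IsCommutativeRing)
open import Relation.Binary.Structures using (IsStrictTotalOrder)

record RealField : Set₁ where
  infixl 6 _+_ _-_
  infix 8 -_
  infix 9 _⁻¹
  infixl 7 _*_
  infix 4 _<_ _≤_
  field
    ℝ   : Set
    _+_ _*_ : ℝ → ℝ → ℝ
    -_  : ℝ → ℝ
    0# 1# : ℝ
    _⁻¹ : ℝ → ℝ
    _<_ : ℝ → ℝ → Set
    isCommutativeRing : IsCommutativeRing _≡_ _+_ _*_ -_ 0# 1#
    0≢1 : ¬ (0# ≡ 1#)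
    ⁻¹-inverse : ∀ x → ¬ (x ≡ 0#) → x * (x ⁻¹) ≡ 1#
    isStrictTotalOrder : IsStrictTotalOrder _≡_ _<_
    +-mono-< : ∀ x y z → x < y → x + z < y + z
    *-pos : ∀ x y → 0# < x → 0# < y → 0# < x * y

  _≤_ : ℝ → ℝ → Set
  x ≤ y = x < y ⊎ x ≡ y

  IsUpperBound : (ℝ → Set) → ℝ → Set
  IsUpperBound P u = ∀ x → P x → x ≤ u

  field
    sup : ∀ (P : ℝ → Set) → ∃ P → ∃ (IsUpperBound P) →
          ∃ λ s → IsUpperBound P s × (∀ u → IsUpperBound P u → s ≤ u)

  _-_ : ℝ → ℝ → ℝ
  x - y = x + (- y)

module Geometry (R : RealField) where
  open RealField R

  V7 : Set
  V7 = Fin 7 → ℝ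

  x0 x1 x2 x3 x4 x5 x6 : V7 → ℝ
  x0 v = v zero
  x1 v = v (suc zero)
  x2 v = v (suc (suc zero))
  x3 v = v (suc (suc (suc zero)))
  x4 v = v (suc (suc (suc (suc zero))))
  x5 v = v (suc (suc (suc (suc (suc zero)))))
  x6 v = v (suc (suc (suc (suc (suc (suc zero))))))

  _⊕_ : V7 → V7 → V7
  (u ⊕ v) i = u i + v i

  Q : V7 → ℝ
  Q v = x0 v * x0 v + x1 v * x1 v + x2 v * x2 v
        - x3 v * x3 v - x4 v * x4 v - x5 v * x5 v - x6 v * x6 v

  B : V7 → V7 → ℝ
  B u v = (Q (u ⊕ v) - Q u - Q v) * ((1# + 1#) ⁻¹)

  NonZero : V7 → Set
  NonZero v = ¬ (∀ i → v i ≡ 0#)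

  -- a nonzero vector representing a point of Δ (a singular 1-space)
  Singular : V7 → Set
  Singular v = NonZero v × Q v ≡ 0#

  record Quaternion : Set where
    constructor quat
    field a b c d : ℝ

  open Quaternion public

  IsUnit : Quaternion → Set
  IsUnit q = a q * a q + b q * b q + c q * c q + d q * d q ≡ 1#

  oneQ : Quaternion
  oneQ = quat 1# 0# 0# 0#

  qmul : Quaternion → Quaternion → Quaternion
  qmul (quat a₁ b₁ c₁ d₁) (quat w x y z) =
    quat (a₁ * w - b₁ * x - c₁ * y - d₁ * z)
         (a₁ * x + b₁ * w + c₁ * z - d₁ * y)
         (a₁ * y - b₁ * z + c₁ * w + d₁ * x)
         (a₁ * z + b₁ * y - c₁ * x + d₁ * w)

  -- the left isoclinic rotation v ↦ q v on (X3,X4,X5,X6), identity on X0,X1,X2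
  act : Quaternion → V7 → V7
  act q v zero = x0 v
  act q v (suc zero) = x1 v
  act q v (suc (suc zero)) = x2 v
  act q v (suc (suc (suc zero))) = a (qmul q (quat (x3 v) (x4 v) (x5 v) (x6 v)))
  act q v (suc (suc (suc (suc zero)))) = b (qmul q (quat (x3 v) (x4 v) (x5 v) (x6 v)))
  act q v (suc (suc (suc (suc (suc zero))))) = c (qmul q (quat (x3 v) (x4 v) (x5 v) (x6 v)))
  act q v (suc (suc (suc (suc (suc (suc zero)))))) = d (qmul q (quat (x3 v) (x4 v) (x5 v) (x6 v)))

module Submission where

-- Split a vector v of ℝ⁷ as v = (x , y) with x ∈ ℝ³ and
-- y ∈ ℝ⁴ ≅ ℍ, so that Q(v) = |x|² − |y|².  A left isoclinic rotation
-- h : y ↦ q y fixes x and, since ⟨y , q y⟩ = Re(q) |y|² for quaternions,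
--
--     B(v , h v) = |x|² − Re(q) |y|².
--
-- If v is singular then |x|² = |y|², hence B(v , h v) = (1 − Re q) |y|².
-- Both factors are nonzero: |y|² = 0 would force |x|² = 0 and v = 0, and
-- Re q = 1 together with |q| = 1 forces q = 1.  A product of nonzero field
-- elements is nonzero, which is the theorem.

open import Defs
open import Level using (Level; 0ℓ)
open import Algebra.Bundles using (CommutativeRing)
import Algebra.Solver.Ring
open import Algebra.Solver.Ring.AlmostCommutativeRing
  using (fromCommutativeRing; _-Raw-AlmostCommutative⟶_)
open import Data.Nat as ℕ using (zero; suc)
open import Data.Integer as ℤ using (ℤ; -[1+_]; _⊖_; sign; ∣_∣) renaming (+_ to pos)
import Data.Integer.Properties as ℤP
import Data.Nat.Properties as ℕP
open import Data.Sign as Sign using (Sign)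
open import Data.Maybe using (Maybe; map)
open import Data.List using (List; []; _∷_; tabulate)
open import Data.List.Relation.Unary.All using (All; []; _∷_)
open import Data.List.Relation.Unary.All.Properties using (tabulate⁻)
open import Data.Product using (_×_; _,_; proj₂)
open import Data.Sum using (inj₁; inj₂)
open import Data.Empty using (⊥-elim)
open import Relation.Nullary using (¬_; yes; no)
open import Relation.Binary.Consequences using (dec⇒weaklyDec)
open import Relation.Binary.Definitions using (tri<; tri≈; tri>)
open import Relation.Binary.Structures using (IsStrictTotalOrder)
open import Relation.Binary.PropositionalEquality as ≡ using (_≡_)

-- A ring solver with integer coefficients for an arbitrary commutative
-- ring.  Its only ingredient is the canonical ring homomorphism ℤ → R,
-- n ↦ n · 1.
module IntegerCoefficientSolver {c ℓ : Level} (R : CommutativeRing c ℓ) where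

  open CommutativeRing R
  open import Algebra.Properties.Ring ring using (-1*x≈-x; -‿involutive; -0#≈0#)
  open import Algebra.Properties.Semiring.Mult semiring
    using (×-homo-+; ×1-homo-*) renaming (_×_ to _·_)
  open import Algebra.Properties.CommutativeSemigroup +-commutativeSemigroup
    using () renaming (interchange to +-interchange)
  open import Algebra.Properties.CommutativeSemigroup *-commutativeSemigroup
    using () renaming (interchange to *-interchange)
  open import Algebra.Properties.AbelianGroup +-abelianGroup using (⁻¹-∙-comm)
  open import Relation.Binary.Reasoning.Setoid setoid

  ⟦_⟧ : ℤ → Carrier
  ⟦ pos n ⟧    = n · 1#
  ⟦ -[1+ n ] ⟧ = - (suc n · 1#)

  -- The image of a sign, so that ⟦ s ◃ n ⟧ ≈ ⟦ s ⟧ₛ * n · 1.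
  ⟦_⟧ₛ : Sign → Carrier
  ⟦ Sign.+ ⟧ₛ = 1#
  ⟦ Sign.- ⟧ₛ = - 1#

  -- Every integer operation reduces to natural subtraction m ⊖ n, so this
  -- is the key case of additivity.
  ⊖-homo : ∀ m n → ⟦ m ⊖ n ⟧ ≈ m · 1# - n · 1#
  ⊖-homo m zero = sym (trans (+-congˡ -0#≈0#) (+-identityʳ _))
  ⊖-homo zero (suc n) = sym (+-identityˡ _)
  ⊖-homo (suc m) (suc n) = begin
    ⟦ suc m ⊖ suc n ⟧                   ≡⟨ ≡.cong ⟦_⟧ (ℤP.[1+m]⊖[1+n]≡m⊖n m n) ⟩
    ⟦ m ⊖ n ⟧                           ≈⟨ ⊖-homo m n ⟩
    m · 1# - n · 1#                     ≈⟨ +-identityˡ _ ⟨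
    0# + (m · 1# - n · 1#)              ≈⟨ +-congʳ (-‿inverseʳ 1#) ⟨
    (1# - 1#) + (m · 1# - n · 1#)       ≈⟨ +-interchange 1# (- 1#) (m · 1#) (- (n · 1#)) ⟩
    (1# + m · 1#) + (- 1# + - (n · 1#)) ≈⟨ +-congˡ (⁻¹-∙-comm 1# (n · 1#)) ⟩
    suc m · 1# - suc n · 1#             ∎

  +-homo : ∀ i j → ⟦ i ℤ.+ j ⟧ ≈ ⟦ i ⟧ + ⟦ j ⟧
  +-homo (pos m) (pos n) = ×-homo-+ 1# m n
  +-homo (pos m) -[1+ n ] = ⊖-homo m (suc n)
  +-homo -[1+ m ] (pos n) = trans (⊖-homo n (suc m)) (+-comm _ _)
  +-homo -[1+ m ] -[1+ n ] = begin
    - (suc (suc (m ℕ.+ n)) · 1#)    ≡⟨ ≡.cong (λ k → - (suc k · 1#)) (ℕP.+-suc m n) ⟨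
    - ((suc m ℕ.+ suc n) · 1#)      ≈⟨ -‿cong (×-homo-+ 1# (suc m) (suc n)) ⟩
    - (suc m · 1# + suc n · 1#)     ≈⟨ ⁻¹-∙-comm _ _ ⟨
    - (suc m · 1#) + - (suc n · 1#) ∎

  sign-homo : ∀ s t → ⟦ s Sign.* t ⟧ₛ ≈ ⟦ s ⟧ₛ * ⟦ t ⟧ₛ
  sign-homo Sign.+ t = sym (*-identityˡ _)
  sign-homo Sign.- Sign.+ = sym (*-identityʳ _)
  sign-homo Sign.- Sign.- = sym (trans (-1*x≈-x (- 1#)) (-‿involutive 1#))

  ◃-homo : ∀ s n → ⟦ s ℤ.◃ n ⟧ ≈ ⟦ s ⟧ₛ * (n · 1#)
  ◃-homo s zero = sym (zeroʳ _)
  ◃-homo Sign.+ (suc n) = sym (*-identityˡ _)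
  ◃-homo Sign.- (suc n) = sym (-1*x≈-x _)

  sign-abs : ∀ i → ⟦ i ⟧ ≈ ⟦ sign i ⟧ₛ * (∣ i ∣ · 1#)
  sign-abs (pos n) = sym (*-identityˡ _)
  sign-abs -[1+ n ] = sym (-1*x≈-x _)

  *-homo : ∀ i j → ⟦ i ℤ.* j ⟧ ≈ ⟦ i ⟧ * ⟦ j ⟧
  *-homo i j = begin
    ⟦ i ℤ.* j ⟧                                               ≈⟨ ◃-homo (sign i Sign.* sign j) (∣ i ∣ ℕ.* ∣ j ∣) ⟩
    ⟦ sign i Sign.* sign j ⟧ₛ * ((∣ i ∣ ℕ.* ∣ j ∣) · 1#)        ≈⟨ *-cong (sign-homo (sign i) (sign j)) (×1-homo-* ∣ i ∣ ∣ j ∣) ⟩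
    (⟦ sign i ⟧ₛ * ⟦ sign j ⟧ₛ) * ((∣ i ∣ · 1#) * (∣ j ∣ · 1#)) ≈⟨ *-interchange _ _ _ _ ⟩
    (⟦ sign i ⟧ₛ * (∣ i ∣ · 1#)) * (⟦ sign j ⟧ₛ * (∣ j ∣ · 1#)) ≈⟨ *-cong (sign-abs i) (sign-abs j) ⟨
    ⟦ i ⟧ * ⟦ j ⟧                                             ∎

  neg-homo : ∀ i → ⟦ ℤ.- i ⟧ ≈ - ⟦ i ⟧
  neg-homo (pos zero) = sym -0#≈0#
  neg-homo (pos (suc n)) = refl
  neg-homo -[1+ n ] = sym (-‿involutive _)

  homomorphism : ℤ.+-*-rawRing -Raw-AlmostCommutative⟶ fromCommutativeRing R
  homomorphism = record
    { ⟦_⟧ = ⟦_⟧ ; +-homo = +-homo ; *-homo = *-homo ; -‿homo = neg-homo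
    ; 0-homo = refl ; 1-homo = +-identityʳ 1# }

  coefficient-test : ∀ i j → Maybe (⟦ i ⟧ ≈ ⟦ j ⟧)
  coefficient-test i j = map (λ i≡j → reflexive (≡.cong ⟦_⟧ i≡j)) (dec⇒weaklyDec ℤ._≟_ i j)

  open Algebra.Solver.Ring ℤ.+-*-rawRing (fromCommutativeRing R)
    homomorphism coefficient-test public
    using (solve; _:=_; _:+_; _:*_; _:-_; :-_; con; Polynomial)

module PolarGeometry (R : RealField) where

  open RealField R
  open Geometry R
  open ≡ using (refl; sym; trans; cong; cong₂; subst; subst₂; module ≡-Reasoning)
  open ≡-Reasoning

  ℝ-commutativeRing : CommutativeRing 0ℓ 0ℓ
  ℝ-commutativeRing = record { isCommutativeRing = isCommutativeRing }

  open CommutativeRing ℝ-commutativeRing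
    using (+-comm; +-identityˡ; +-identityʳ; *-identityˡ; *-identityʳ; *-comm; *-assoc;
           zeroʳ; distribˡ; distribʳ; -‿inverseʳ; ring; +-group)
  open import Algebra.Properties.Ring ring using (-‿distribˡ-*)
  open import Algebra.Properties.Group +-group using (x∙y⁻¹≈ε⇒x≈y)
  open IntegerCoefficientSolver ℝ-commutativeRing
    using (solve; _:=_; _:+_; _:*_; _:-_; :-_; con; Polynomial)
  open IsStrictTotalOrder isStrictTotalOrder using (compare; irrefl; _≟_)
    renaming (trans to <-trans)

  negate-negative : ∀ {x} → x < 0# → 0# < - x
  negate-negative {x} x<0 =
    subst₂ _<_ (-‿inverseʳ x) (+-identityˡ (- x)) (+-mono-< x 0# (- x) x<0)

  square-positive : ∀ {x} → ¬ x ≡ 0# → 0# < x * x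
  square-positive {x} x≢0 with compare x 0#
  ... | tri< x<0 _ _ = subst (0# <_) (neg-square x) (*-pos _ _ (negate-negative x<0) (negate-negative x<0))
    where
    neg-square : ∀ x → (- x) * (- x) ≡ x * x
    neg-square = solve 1 (λ x → (:- x) :* (:- x) := x :* x) refl
  ... | tri≈ _ x≡0 _ = ⊥-elim (x≢0 x≡0)
  ... | tri> _ _ 0<x = *-pos x x 0<x 0<x

  square-nonnegative : ∀ x → 0# ≤ x * x
  square-nonnegative x with x ≟ 0#
  ... | yes x≡0 = inj₂ (sym (trans (cong (x *_) x≡0) (zeroʳ x)))
  ... | no x≢0 = inj₁ (square-positive x≢0)

  square-zero : ∀ {x} → x * x ≡ 0# → x ≡ 0#
  square-zero {x} x²≡0 with x ≟ 0#
  ... | yes x≡0 = x≡0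
  ... | no x≢0 = ⊥-elim (irrefl refl (subst (0# <_) x²≡0 (square-positive x≢0)))

  positive+nonnegative : ∀ {x y} → 0# < x → 0# ≤ y → 0# < x + y
  positive+nonnegative {x} {y} 0<x (inj₁ 0<y) =
    <-trans (subst (0# <_) (sym (+-identityˡ y)) 0<y) (+-mono-< 0# x y 0<x)
  positive+nonnegative {x} 0<x (inj₂ 0≡y) =
    subst (λ t → 0# < x + t) 0≡y (subst (0# <_) (sym (+-identityʳ x)) 0<x)

  nonnegative+nonnegative : ∀ {x y} → 0# ≤ x → 0# ≤ y → 0# ≤ x + y
  nonnegative+nonnegative (inj₁ 0<x) 0≤y = inj₁ (positive+nonnegative 0<x 0≤y)
  nonnegative+nonnegative {y = y} (inj₂ 0≡x) 0≤y =
    subst (λ t → 0# ≤ t + y) 0≡x (subst (0# ≤_) (sym (+-identityˡ y)) 0≤y)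

  nonnegative-sum-zero : ∀ {x y} → 0# ≤ x → 0# ≤ y → x + y ≡ 0# → x ≡ 0# × y ≡ 0#
  nonnegative-sum-zero 0≤x 0≤y x+y≡0 =
    first-zero 0≤x 0≤y x+y≡0 , first-zero 0≤y 0≤x (trans (+-comm _ _) x+y≡0)
    where
    first-zero : ∀ {x y} → 0# ≤ x → 0# ≤ y → x + y ≡ 0# → x ≡ 0#
    first-zero (inj₂ 0≡x) _ _ = sym 0≡x
    first-zero (inj₁ 0<x) 0≤y x+y≡0 =
      ⊥-elim (irrefl refl (subst (0# <_) x+y≡0 (positive+nonnegative 0<x 0≤y)))

  sumSq : List ℝ → ℝ
  sumSq []       = 0#
  sumSq (x ∷ xs) = x * x + sumSq xs

  sumSq-nonnegative : ∀ xs → 0# ≤ sumSq xs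
  sumSq-nonnegative []       = inj₂ refl
  sumSq-nonnegative (x ∷ xs) = nonnegative+nonnegative (square-nonnegative x) (sumSq-nonnegative xs)

  sumSq-zero : ∀ xs → sumSq xs ≡ 0# → All (_≡ 0#) xs
  sumSq-zero []       _ = []
  sumSq-zero (x ∷ xs) s≡0 with nonnegative-sum-zero (square-nonnegative x) (sumSq-nonnegative xs) s≡0
  ... | x²≡0 , rest≡0 = square-zero x²≡0 ∷ sumSq-zero xs rest≡0

  product-nonzero : ∀ {x y} → ¬ x ≡ 0# → ¬ y ≡ 0# → ¬ x * y ≡ 0#
  product-nonzero {x} {y} x≢0 y≢0 xy≡0 = y≢0 (begin
    y                   ≡⟨ sym (*-identityˡ y) ⟩
    1# * y              ≡⟨ cong (_* y) (sym (trans (*-comm _ _) (⁻¹-inverse x x≢0))) ⟩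
    (x ⁻¹ * x) * y      ≡⟨ *-assoc _ _ _ ⟩
    x ⁻¹ * (x * y)      ≡⟨ cong (x ⁻¹ *_) xy≡0 ⟩
    x ⁻¹ * 0#           ≡⟨ zeroʳ _ ⟩
    0#                  ∎)

  two-nonzero : ¬ 1# + 1# ≡ 0#
  two-nonzero 2≡0 = irrefl refl (subst (0# <_) 2≡0 (positive+nonnegative 0<1 (inj₁ 0<1)))
    where
    0<1 : 0# < 1#
    0<1 = subst (0# <_) (*-identityˡ 1#) (square-positive (λ 1≡0 → 0≢1 (sym 1≡0)))

  half-of-double : ∀ x → (x + x) * (1# + 1#) ⁻¹ ≡ x
  half-of-double x = begin
    (x + x) * two ⁻¹    ≡⟨ cong (_* two ⁻¹) (double x) ⟩
    (x * two) * two ⁻¹  ≡⟨ *-assoc _ _ _ ⟩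
    x * (two * two ⁻¹)  ≡⟨ cong (x *_) (⁻¹-inverse two two-nonzero) ⟩
    x * 1#              ≡⟨ *-identityʳ x ⟩
    x                   ∎
    where
    two = 1# + 1#
    double : ∀ x → x + x ≡ x * two
    double x = sym (trans (distribˡ x 1# 1#) (cong₂ _+_ (*-identityʳ x) (*-identityʳ x)))

  positivePart negativePart : V7 → ℝ
  positivePart v = sumSq (x0 v ∷ x1 v ∷ x2 v ∷ [])
  negativePart v = sumSq (x3 v ∷ x4 v ∷ x5 v ∷ x6 v ∷ [])

  sumSqₚ : ∀ {n} → List (Polynomial n) → Polynomial n
  sumSqₚ []       = con (pos 0)
  sumSqₚ (p ∷ ps) = p :* p :+ sumSqₚ ps

  Qₚ : ∀ {n} → (y₀ y₁ y₂ y₃ y₄ y₅ y₆ : Polynomial n) → Polynomial n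
  Qₚ y₀ y₁ y₂ y₃ y₄ y₅ y₆ =
    y₀ :* y₀ :+ y₁ :* y₁ :+ y₂ :* y₂ :- y₃ :* y₃ :- y₄ :* y₄ :- y₅ :* y₅ :- y₆ :* y₆

  Q-split : ∀ v → Q v ≡ positivePart v - negativePart v
  Q-split v = solve 7 (λ y₀ y₁ y₂ y₃ y₄ y₅ y₆ →
      Qₚ y₀ y₁ y₂ y₃ y₄ y₅ y₆ := sumSqₚ (y₀ ∷ y₁ ∷ y₂ ∷ []) :- sumSqₚ (y₃ ∷ y₄ ∷ y₅ ∷ y₆ ∷ []))
    refl (x0 v) (x1 v) (x2 v) (x3 v) (x4 v) (x5 v) (x6 v)

  -- Polarisation of Q along a left isoclinic rotation: the rotation fixes
  -- x and ⟨y , q y⟩ = Re(q) |y|², so Q(v + qv) − Q(v) − Q(qv) is twice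
  -- |x|² − Re(q) |y|².  No unit-length assumption on q is needed.
  polarisation : Quaternion → V7 → ℝ
  polarisation q v = positivePart v - a q * negativePart v

  doubled-polarisation : ∀ q v →
    Q (v ⊕ act q v) - Q v - Q (act q v) ≡ polarisation q v + polarisation q v
  doubled-polarisation q v = solve 11 (λ α β γ δ y₀ y₁ y₂ y₃ y₄ y₅ y₆ →
      let z₃ = α :* y₃ :- β :* y₄ :- γ :* y₅ :- δ :* y₆
          z₄ = α :* y₄ :+ β :* y₃ :+ γ :* y₆ :- δ :* y₅
          z₅ = α :* y₅ :- β :* y₆ :+ γ :* y₃ :+ δ :* y₄
          z₆ = α :* y₆ :+ β :* y₅ :- γ :* y₄ :+ δ :* y₃
          p  = sumSqₚ (y₀ ∷ y₁ ∷ y₂ ∷ []) :- α :* sumSqₚ (y₃ ∷ y₄ ∷ y₅ ∷ y₆ ∷ [])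
      in  Qₚ (y₀ :+ y₀) (y₁ :+ y₁) (y₂ :+ y₂) (y₃ :+ z₃) (y₄ :+ z₄) (y₅ :+ z₅) (y₆ :+ z₆)
            :- Qₚ y₀ y₁ y₂ y₃ y₄ y₅ y₆ :- Qₚ y₀ y₁ y₂ z₃ z₄ z₅ z₆
          := p :+ p)
    refl (a q) (b q) (c q) (d q) (x0 v) (x1 v) (x2 v) (x3 v) (x4 v) (x5 v) (x6 v)

  B-rotation : ∀ q v → B v (act q v) ≡ polarisation q v
  B-rotation q v = trans (cong (_* (1# + 1#) ⁻¹) (doubled-polarisation q v))
                         (half-of-double (polarisation q v))

  -- On a singular vector the positive and negative parts agree, and they
  -- are nonzero because a vector with |x|² = |y|² = 0 is zero.
  singular-balanced : ∀ v → Q v ≡ 0# → positivePart v ≡ negativePart v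
  singular-balanced v Qv≡0 = x∙y⁻¹≈ε⇒x≈y _ _ (trans (sym (Q-split v)) Qv≡0)

  singular-negativePart-nonzero : ∀ {v} → Singular v → ¬ negativePart v ≡ 0#
  singular-negativePart-nonzero {v} (v≢0 , Qv≡0) y≡0 =
    v≢0 (tabulate⁻ (sumSq-zero (tabulate v) (begin
      sumSq (tabulate v)                ≡⟨ all-coordinates v ⟩
      positivePart v + negativePart v   ≡⟨ cong₂ _+_ (trans (singular-balanced v Qv≡0) y≡0) y≡0 ⟩
      0# + 0#                           ≡⟨ +-identityˡ 0# ⟩
      0#                                ∎)))
    where
    all-coordinates : ∀ v → sumSq (tabulate v) ≡ positivePart v + negativePart v
    all-coordinates v = solve 7 (λ y₀ y₁ y₂ y₃ y₄ y₅ y₆ →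
        sumSqₚ (y₀ ∷ y₁ ∷ y₂ ∷ y₃ ∷ y₄ ∷ y₅ ∷ y₆ ∷ [])
          := sumSqₚ (y₀ ∷ y₁ ∷ y₂ ∷ []) :+ sumSqₚ (y₃ ∷ y₄ ∷ y₅ ∷ y₆ ∷ []))
      refl (x0 v) (x1 v) (x2 v) (x3 v) (x4 v) (x5 v) (x6 v)

  B-rotation-singular : ∀ q v → Q v ≡ 0# → B v (act q v) ≡ (1# - a q) * negativePart v
  B-rotation-singular q v Qv≡0 = begin
    B v (act q v)                           ≡⟨ B-rotation q v ⟩
    positivePart v - a q * negativePart v   ≡⟨ cong (λ p → p - a q * negativePart v) (singular-balanced v Qv≡0) ⟩
    negativePart v - a q * negativePart v   ≡⟨ factor (a q) (negativePart v) ⟩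
    (1# - a q) * negativePart v             ∎
    where
    factor : ∀ α w → w - α * w ≡ (1# - α) * w
    factor α w = sym (trans (distribʳ w 1# (- α)) (cong₂ _+_ (*-identityˡ w) (sym (-‿distribˡ-* α w))))

  -- A unit quaternion with real part 1 is the identity: 1 = a² + b² + c² + d²
  -- and a = 1 force b² + c² + d² = 0.
  unit-real-part : ∀ {q} → IsUnit q → ¬ q ≡ oneQ → ¬ 1# - a q ≡ 0#
  unit-real-part {q} unit q≢1 1-a≡0 = q≢1 (oneQ-from (sumSq-zero (b q ∷ c q ∷ d q ∷ []) (begin
      sumSq (b q ∷ c q ∷ d q ∷ [])                           ≡⟨ imaginary-norm (a q) (b q) (c q) (d q) ⟩
      (a q * a q + b q * b q + c q * c q + d q * d q) - a q * a q ≡⟨ cong₂ (λ n r → n - r * r) unit (sym 1≡a) ⟩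
      1# - 1# * 1#                                           ≡⟨ cong (λ r → 1# - r) (*-identityˡ 1#) ⟩
      1# - 1#                                                ≡⟨ -‿inverseʳ 1# ⟩
      0#                                                     ∎)))
    where
    1≡a : 1# ≡ a q
    1≡a = x∙y⁻¹≈ε⇒x≈y _ _ 1-a≡0
    imaginary-norm : ∀ α β γ δ → sumSq (β ∷ γ ∷ δ ∷ []) ≡ (α * α + β * β + γ * γ + δ * δ) - α * α
    imaginary-norm = solve 4 (λ α β γ δ →
      sumSqₚ (β ∷ γ ∷ δ ∷ []) := (α :* α :+ β :* β :+ γ :* γ :+ δ :* δ) :- α :* α) refl
    quat-cong : ∀ {α β γ δ α′ β′ γ′ δ′} → α ≡ α′ → β ≡ β′ → γ ≡ γ′ → δ ≡ δ′ →
                quat α β γ δ ≡ quat α′ β′ γ′ δ′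
    quat-cong refl refl refl refl = refl
    oneQ-from : All (_≡ 0#) (b q ∷ c q ∷ d q ∷ []) → q ≡ oneQ
    oneQ-from (b≡0 ∷ c≡0 ∷ d≡0 ∷ []) = quat-cong (sym 1≡a) b≡0 c≡0 d≡0

lemma4p4 : (R : RealField) → let open Geometry R in
    (q : Quaternion) → IsUnit q → ¬ (q ≡ oneQ) →
    (v : V7) → Singular v → ¬ (B v (act q v) ≡ RealField.0# R)
lemma4p4 R q unit q≢1 v singular B≡0 =
  product-nonzero (unit-real-part unit q≢1) (singular-negativePart-nonzero singular)
    (≡.trans (≡.sym (B-rotation-singular q v (proj₂ singular))) B≡0)
  where open PolarGeometry R
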